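{- Let $G$ be a graph with a $\kappa$-partition $\mathcal{P}$, and let $X\subseteq V(G)$ be a feedback vertex set of $G$ (i.e., $G-X$ is a forest). Then $|V_i\setminus X|\le 2\kappa$ for every $V_i\in\mathcal{P}$.
   Context: A $\kappa$-partition of $G$ is a partition $\mathcal{P}$ of $V(G)$ into sets $V_i$ each inducing a connected subgraph and each a union of at most $\kappa$ (not necessarily disjoint) cliques of $G$. -}

module Defs where

open import Data.Nat using (ℕ; _≤_)
open import Data.Fin using (Fin)
open import Data.Fin.Subset using (Subset; _∈_; ∁; ⋃; Nonempty)
open import Data.List using (List; []; _∷_; _++_; [_]; length)
open import Data.List.Relation.Unary.All using (All)
open import Data.List.Relation.Unary.Linked using (Linked)
open import Data.List.Relation.Unary.Unique.Propositional using (Unique)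
open import Data.Product using (Σ; ∃; _×_)
open import Relation.Nullary using (¬_)
open import Relation.Binary.PropositionalEquality using (_≡_; _≢_)

record Graph (n : ℕ) : Set₁ where
  field
    Adj     : Fin n → Fin n → Set
    symAdj  : ∀ {u v} → Adj u v → Adj v u
    irrefl  : ∀ {u} → ¬ Adj u u
open Graph public

module _ {n : ℕ} (G : Graph n) where

  IsClique : Subset n → Set
  IsClique C = ∀ u v → u ∈ C → v ∈ C → u ≢ v → Adj G u v

  -- A walk from u to v all of whose vertices lie in S (u assumed in S).
  data WalkIn (S : Subset n) : Fin n → Fin n → Set where
    here : ∀ {u} → WalkIn S u u
    step : ∀ {u w v} → Adj G u w → w ∈ S → WalkIn S w v → WalkIn S u v

  InducesConnected : Subset n → Set
  InducesConnected S = ∀ u v → u ∈ S → v ∈ S → WalkIn S u v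

  UnionOfCliques : ℕ → Subset n → Set
  UnionOfCliques κ S =
    Σ (List (Subset n)) λ Cs → length Cs ≤ κ × All IsClique Cs × ⋃ Cs ≡ S

  IsPartition : ∀ {m} → (Fin m → Subset n) → Set
  IsPartition {m} P =
    (∀ i → Nonempty (P i)) ×
    (∀ v → ∃ λ i → v ∈ P i) ×
    (∀ v i j → v ∈ P i → v ∈ P j → i ≡ j)

  IsKappaPartition : ℕ → ∀ {m} → (Fin m → Subset n) → Set
  IsKappaPartition κ P =
    IsPartition P × (∀ i → InducesConnected (P i) × UnionOfCliques κ (P i))

  CycleIn : Subset n → Set
  CycleIn S = Σ (Fin n) λ v → Σ (List (Fin n)) λ rest →
    2 ≤ length rest × Unique (v ∷ rest) × All (_∈ S) (v ∷ rest) ×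
    Linked (Adj G) (v ∷ rest ++ [ v ])

  IsFeedbackVertexSet : Subset n → Set
  IsFeedbackVertexSet X = ¬ CycleIn (∁ X)

-- A clique meets a forest in at most two vertices, since three of its vertices
-- outside X would form a triangle in G − X. A part of a κ-partition is a union of
-- at most κ cliques, so at most 2κ of its vertices lie outside X.
module Submission where

open import Defs
open import Data.Bool using (_∨_)
open import Data.Empty using (⊥; ⊥-elim)
open import Data.Fin using (Fin; zero; suc; _≟_)
open import Data.Fin.Properties using (suc-injective)
open import Data.Fin.Subset
  using (Subset; ∣_∣; _─_; _∪_; _∈_; _∉_; ∁; ⋃; Empty; inside; outside)
open import Data.Fin.Subset.Properties
  using (Empty-unique; ∣⊥∣≡0; ∣p─q∣≤∣p∣; p─q⊆p; x∉p⇒x∈∁p)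
open import Data.List using (List; []; _∷_; length)
open import Data.List.Relation.Unary.All as All using (All; []; _∷_)
open import Data.List.Relation.Unary.AllPairs using ([]; _∷_)
open import Data.List.Relation.Unary.Linked using ([-]; _∷_)
open import Data.Nat using (ℕ; _≤_; _*_; _+_; z≤n; s≤s)
open import Data.Nat.Properties
  using (module ≤-Reasoning; ≤-trans; ≤-reflexive; +-mono-≤; +-monoʳ-≤; *-monoˡ-≤; *-comm; +-suc; n≤1+n)
open import Data.Product using (_,_)
open import Data.Vec using ([]; _∷_; here; there)
open import Function using (_∘_)
open import Relation.Nullary using (yes; no)
open import Relation.Binary.PropositionalEquality using (_≡_; _≢_; refl; cong; sym; subst)

private
  variable
    n : ℕ

x∈p─q⇒x∉q : ∀ {x : Fin n} {p q : Subset n} → x ∈ p ─ q → x ∉ q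
x∈p─q⇒x∉q {p = _ ∷ _} {inside  ∷ _} ()            here
x∈p─q⇒x∉q {p = _ ∷ _} {_ ∷ _}       (there x∈p─q) (there x∈q) = x∈p─q⇒x∉q x∈p─q x∈q

─-distribʳ-∪ : ∀ (p q r : Subset n) → (p ∪ q) ─ r ≡ (p ─ r) ∪ (q ─ r)
─-distribʳ-∪ []      []      []            = refl
─-distribʳ-∪ (_ ∷ p) (_ ∷ q) (inside  ∷ r) = cong (outside ∷_) (─-distribʳ-∪ p q r)
─-distribʳ-∪ (s ∷ p) (t ∷ q) (outside ∷ r) = cong ((s ∨ t) ∷_) (─-distribʳ-∪ p q r)

∣p∪q∣≤∣p∣+∣q∣ : ∀ (p q : Subset n) → ∣ p ∪ q ∣ ≤ ∣ p ∣ + ∣ q ∣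
∣p∪q∣≤∣p∣+∣q∣ []            []            = z≤n
∣p∪q∣≤∣p∣+∣q∣ (outside ∷ p) (outside ∷ q) = ∣p∪q∣≤∣p∣+∣q∣ p q
∣p∪q∣≤∣p∣+∣q∣ (inside  ∷ p) (outside ∷ q) = s≤s (∣p∪q∣≤∣p∣+∣q∣ p q)
∣p∪q∣≤∣p∣+∣q∣ (outside ∷ p) (inside  ∷ q) =
  ≤-trans (s≤s (∣p∪q∣≤∣p∣+∣q∣ p q)) (≤-reflexive (sym (+-suc ∣ p ∣ ∣ q ∣)))
∣p∪q∣≤∣p∣+∣q∣ (inside  ∷ p) (inside  ∷ q) =
  s≤s (≤-trans (∣p∪q∣≤∣p∣+∣q∣ p q) (+-monoʳ-≤ ∣ p ∣ (n≤1+n ∣ q ∣)))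

∣⋃ps─r∣≤length*k : ∀ {k} (ps : List (Subset n)) (r : Subset n) →
                   All (λ p → ∣ p ─ r ∣ ≤ k) ps → ∣ ⋃ ps ─ r ∣ ≤ length ps * k
∣⋃ps─r∣≤length*k {n} []       r []         =
  subst (∣ ⋃ [] ─ r ∣ ≤_) (∣⊥∣≡0 n) (∣p─q∣≤∣p∣ (⋃ []) r)
∣⋃ps─r∣≤length*k     (p ∷ ps) r (p≤k ∷ ps≤k) rewrite ─-distribʳ-∪ p (⋃ ps) r =
  ≤-trans (∣p∪q∣≤∣p∣+∣q∣ (p ─ r) (⋃ ps ─ r)) (+-mono-≤ p≤k (∣⋃ps─r∣≤length*k ps r ps≤k))

∣p∣≤0 : {p : Subset n} → Empty p → ∣ p ∣ ≤ 0
∣p∣≤0 {n} p-empty rewrite Empty-unique p-empty = ≤-reflexive (∣⊥∣≡0 n)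

∣p∣≤1 : {p : Subset n} → (∀ {x y} → x ∈ p → y ∈ p → x ≡ y) → ∣ p ∣ ≤ 1
∣p∣≤1 {p = []}          _     = z≤n
∣p∣≤1 {p = inside  ∷ p} equal = s≤s (∣p∣≤0 λ where (x , x∈p) → zero≢suc (equal here (there x∈p)))
  where
  zero≢suc : ∀ {x : Fin n} → zero ≢ suc x
  zero≢suc ()
∣p∣≤1 {p = outside ∷ p} equal = ∣p∣≤1 λ x∈p y∈p → suc-injective (equal (there x∈p) (there y∈p))

NoThreeDistinct : Subset n → Set
NoThreeDistinct p = ∀ {x y z} → x ∈ p → y ∈ p → z ∈ p → x ≢ y → y ≢ z → x ≢ z → ⊥

∣p∣≤2 : {p : Subset n} → NoThreeDistinct p → ∣ p ∣ ≤ 2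
∣p∣≤2 {p = []}          _        = z≤n
∣p∣≤2 {p = inside  ∷ p} no-three = s≤s (∣p∣≤1 equal)
  where
  equal : ∀ {x y} → x ∈ p → y ∈ p → x ≡ y
  equal {x} {y} x∈p y∈p with x ≟ y
  ... | yes x≡y = x≡y
  ... | no  x≢y = ⊥-elim (no-three here (there x∈p) (there y∈p) (λ ()) (x≢y ∘ suc-injective) (λ ()))
∣p∣≤2 {p = outside ∷ p} no-three = ∣p∣≤2 λ x∈p y∈p z∈p x≢y y≢z x≢z →
  no-three (there x∈p) (there y∈p) (there z∈p)
    (x≢y ∘ suc-injective) (y≢z ∘ suc-injective) (x≢z ∘ suc-injective)

module _ (G : Graph n) where

  triangle⇒CycleIn : ∀ {S x y z} → x ∈ S → y ∈ S → z ∈ S →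
                     x ≢ y → y ≢ z → x ≢ z →
                     Adj G x y → Adj G y z → Adj G z x → CycleIn G S
  triangle⇒CycleIn {x = x} {y} {z} x∈S y∈S z∈S x≢y y≢z x≢z xy yz zx =
    x , y ∷ z ∷ [] , s≤s (s≤s z≤n) ,
    (x≢y ∷ x≢z ∷ []) ∷ (y≢z ∷ []) ∷ [] ∷ [] ,
    x∈S ∷ y∈S ∷ z∈S ∷ [] ,
    xy ∷ yz ∷ zx ∷ [-]

  ∣clique─feedbackVertexSet∣≤2 : ∀ {C X} → IsClique G C → IsFeedbackVertexSet G X →
                                 ∣ C ─ X ∣ ≤ 2
  ∣clique─feedbackVertexSet∣≤2 {C} {X} clique acyclic = ∣p∣≤2 triangle
    where
    triangle : NoThreeDistinct (C ─ X)
    triangle {x} {y} {z} x∈ y∈ z∈ x≢y y≢z x≢z = acyclic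
      (triangle⇒CycleIn (outsideX x∈) (outsideX y∈) (outsideX z∈) x≢y y≢z x≢z
        (clique x y (inC x∈) (inC y∈) x≢y)
        (clique y z (inC y∈) (inC z∈) y≢z)
        (clique z x (inC z∈) (inC x∈) (x≢z ∘ sym)))
      where
      inC : ∀ {v} → v ∈ C ─ X → v ∈ C
      inC = p─q⊆p C X
      outsideX : ∀ {v} → v ∈ C ─ X → v ∈ ∁ X
      outsideX = x∉p⇒x∈∁p ∘ x∈p─q⇒x∉q

mainTheorem10 : ∀ {n m : ℕ} (G : Graph n) (κ : ℕ) (P : Fin m → Subset n) (X : Subset n) →
    IsKappaPartition G κ P → IsFeedbackVertexSet G X →
    ∀ i → ∣ P i ─ X ∣ ≤ 2 * κ
mainTheorem10 G κ P X (_ , parts) acyclic i with parts i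
... | _ , (Cs , length≤κ , cliques , ⋃Cs≡Pi) = subst (λ S → ∣ S ─ X ∣ ≤ 2 * κ) ⋃Cs≡Pi (begin
  ∣ ⋃ Cs ─ X ∣   ≤⟨ ∣⋃ps─r∣≤length*k Cs X (All.map clique-bound cliques) ⟩
  length Cs * 2  ≤⟨ *-monoˡ-≤ 2 length≤κ ⟩
  κ * 2          ≡⟨ *-comm κ 2 ⟩
  2 * κ          ∎)
  where
  open ≤-Reasoning
  clique-bound : ∀ {C} → IsClique G C → ∣ C ─ X ∣ ≤ 2
  clique-bound clique = ∣clique─feedbackVertexSet∣≤2 G clique acyclic
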